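{- For every $n \geq 1$, the number $L_n$ of labelled loop-threshold graphs on vertex set $[n]$ satisfies $$L_n = 2\sum_{k=1}^n k!\,S(n,k).$$
   Context: Graphs here are finite, may have loops, but have no multiple edges. A graph is loop-threshold if it belongs to the smallest family of such graphs that contains $K_1$ (a single unlooped vertex) and $K_1^{\rm loop}$ (a single vertex with a loop), and is closed under adding an isolated (unlooped) vertex and adding a looped dominating vertex (a new vertex with a loop, adjacent to all existing vertices). A labelled loop-threshold graph on $[n]=\{1,\ldots,n\}$ is such a graph with vertex set $[n]$; distinct sets of edges and loops give distinct graphs. $S(n,k)$ is the Stirling number of the second kind. -}

module Defs where

open import Data.Nat using (ℕ; zero; suc; _+_; _*_; _!)
open import Data.Nat.ListAction using (sum)
open import Data.Product using (_×_)
open import Data.Bool using (Bool; true; false)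
open import Data.Fin using (Fin; zero; suc; punchIn)
open import Data.Vec using (Vec; lookup; tabulate)
open import Data.List using (List; map; applyUpTo)
open import Relation.Binary.PropositionalEquality using (_≡_)

S : ℕ → ℕ → ℕ
S zero    zero    = 1
S zero    (suc k) = 0
S (suc n) zero    = 0
S (suc n) (suc k) = suc k * S n (suc k) + S n k

fubiniSum : ℕ → ℕ
fubiniSum n = sum (map (λ k → (k !) * S n k) (applyUpTo suc n))

-- A (labelled) graph with possible loops on vertex set Fin n, given by its
-- adjacency matrix: entry (i,j) is true iff {i,j} is an edge (a loop if i = j).
Adj : ℕ → Set
Adj n = Vec (Vec Bool n) n

adj : ∀ {n} → Adj n → Fin n → Fin n → Bool
adj A i j = lookup (lookup A i) j

Symmetric : ∀ {n} → Adj n → Set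
Symmetric {n} A = (i j : Fin n) → adj A i j ≡ adj A j i

delete : ∀ {n} → Adj (suc n) → Fin (suc n) → Adj n
delete A v = tabulate λ i → tabulate λ j → adj A (punchIn v i) (punchIn v j)

-- Loop-threshold graphs (labelled version of the recursive construction):
-- a one-vertex graph (K1 or K1 with loop), or a graph having a vertex v which is
-- an isolated unlooped vertex, resp. a looped dominating vertex, whose deletion
-- leaves a loop-threshold graph.
data LoopThreshold : ∀ {n} → Adj n → Set where
  single    : (A : Adj 1) → LoopThreshold A
  isolated  : ∀ {n} (A : Adj (suc (suc n))) (v : Fin (suc (suc n))) →
              ((j : Fin (suc (suc n))) → adj A v j ≡ false) →
              LoopThreshold (delete A v) → LoopThreshold A
  dominating : ∀ {n} (A : Adj (suc (suc n))) (v : Fin (suc (suc n))) →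
              ((j : Fin (suc (suc n))) → adj A v j ≡ true) →
              LoopThreshold (delete A v) → LoopThreshold A

IsLTGraph : ∀ {n} → Adj n → Set
IsLTGraph A = Symmetric A × LoopThreshold A

-- Build a loop-threshold graph by adding vertices one at a time, each isolated or dominating,
-- and number the maximal runs of equally-typed additions backwards from 0. The runs alternate
-- in type, so if the colour b is the type of the last run, the run of level l is dominating iff
-- alternate b l; and two vertices (or a vertex and itself) are adjacent iff the later of them
-- is dominating, so the adjacency of i and j is alternate b (min (level i) (level j)).
-- Conversely, every colour b with a surjection of levels [n] → [k] yields a loop-threshold graph,
-- and both are recovered from the graph: by induction on l, a vertex has level > l iff its row
-- is not constant on the vertices of level ≥ l. With k! S(n,k) surjections onto [k] and two
-- colours, this gives 2 Σ_k k! S(n,k) graphs.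
module Submission where

open import Defs
open import Data.Bool using (Bool; true; false; not)
open import Data.Bool.Properties using (not-¬; not-injective; ¬-not) renaming (_≟_ to _≟ᵇ_)
open import Data.Empty using (⊥-elim)
open import Data.Fin using (Fin; zero; suc; toℕ; fromℕ; fromℕ<; punchIn; punchOut)
open import Data.Fin.Properties
  using (toℕ<n; toℕ-fromℕ; toℕ-fromℕ<; toℕ-injective; punchIn-punchOut; punchOut-punchIn;
         punchOut-cong; punchInᵢ≢i; punchIn-injective; pigeonhole; any?; _≟_)
  renaming (<⇒≢ to <⇒≢ᶠ)
open import Data.List
  using (List; []; _∷_; [_]; _++_; map; concatMap; cartesianProductWith; length; applyUpTo; allFin)
open import Data.List.Properties using (length-++; length-map; length-tabulate; map-cong)
open import Data.List.Extrema.Nat using (argmin; f[argmin]≤f[xs])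
open import Data.List.Membership.Propositional using (_∈_; lose)
open import Data.List.Membership.Propositional.Properties
  using (∈-++⁺ˡ; ∈-++⁺ʳ; ∈-++⁻; ∈-map⁺; ∈-map⁻; ∈-concatMap⁺; ∈-concatMap⁻;
         ∈-cartesianProductWith⁺; ∈-cartesianProductWith⁻; ∈-allFin; ∈-applyUpTo⁺)
open import Data.List.Relation.Unary.All as All using (All; []; _∷_)
import Data.List.Relation.Unary.All.Properties as All
open import Data.List.Relation.Unary.Any using (here; satisfied)
import Data.List.Relation.Unary.AllPairs as AllPairs
import Data.List.Relation.Unary.AllPairs.Properties as AllPairs
open import Data.List.Relation.Unary.Unique.Propositional using (Unique; []; _∷_)
import Data.List.Relation.Unary.Unique.Propositional.Properties as Unique
open import Data.Nat using (ℕ; zero; suc; _+_; _*_; _!; _⊓_; _≤_; _<_; z≤n; s≤s)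
open import Data.Nat.ListAction using (sum)
open import Data.Nat.Properties
  using (≤-refl; ≤-antisym; <-trans; <⇒≤; <⇒≢; ≮⇒≥; n≤1+n; m≤n⇒m<n∨m≡n; m≤n⇒m⊓n≡m; m≥n⇒m⊓n≡n;
         ⊓-comm; ⊓-zeroʳ; +-identityʳ; *-zeroʳ)
open import Data.Nat.Solver using (module +-*-Solver)
open import Data.Product using (Σ; ∃; ∃₂; _×_; _,_; proj₁; proj₂)
open import Data.Sum using (_⊎_; inj₁; inj₂)
open import Data.Vec as Vec using (Vec; []; _∷_; lookup; tabulate; insertAt) renaming (map to mapᵛ)
open import Data.Vec.Properties
  using (lookup-map; lookup∘tabulate; tabulate-cong; ∷-injective; insertAt-lookup; insertAt-punchIn)
open import Data.Vec.Relation.Binary.Pointwise.Extensional using (ext; Pointwise-≡⇒≡)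
open import Function using (_∘_; _⇔_; mk⇔)
open import Relation.Binary.PropositionalEquality
  using (_≡_; _≢_; _≗_; refl; sym; trans; cong; cong₂; subst; module ≡-Reasoning)
open import Relation.Nullary using (¬_; yes; no)

private
  variable
    m n k k′ : ℕ
    b b′ c : Bool

module _ {A B : Set} where

  length-concatMap : (f : A → List B) (xs : List A) → length (concatMap f xs) ≡ sum (map (length ∘ f) xs)
  length-concatMap f []       = refl
  length-concatMap f (x ∷ xs) = trans (length-++ (f x)) (cong (length (f x) +_) (length-concatMap f xs))

  unique-concatMap⁺ : {f : A → List B} {xs : List A} → Unique xs → (∀ x → Unique (f x)) →
                      (∀ {x x′ y} → y ∈ f x → y ∈ f x′ → x ≡ x′) → Unique (concatMap f xs)
  unique-concatMap⁺ xs! fx! separated =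
    Unique.concat⁺ (All.map⁺ (All.universal fx! _))
                   (AllPairs.map⁺ (AllPairs.map (λ x≢x′ {_} (y∈ , y∈′) → x≢x′ (separated y∈ y∈′)) xs!))

  unique-map⁺-on : {P : A → Set} {g : A → B} → (∀ {x y} → P x → P y → g x ≡ g y → x ≡ y) →
                   {xs : List A} → All P xs → Unique xs → Unique (map g xs)
  unique-map⁺-on inj []         []           = []
  unique-map⁺-on inj (px ∷ pxs) (x∉xs ∷ xs!) =
    All.map⁺ (All.zipWith (λ (x≢y , py) gx≡gy → x≢y (inj px py gx≡gy)) (x∉xs , pxs))
    ∷ unique-map⁺-on inj pxs xs!

length-cartesianProductWith : {A B C : Set} (f : A → B → C) (xs : List A) (ys : List B) →
                              length (cartesianProductWith f xs ys) ≡ length xs * length ys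
length-cartesianProductWith f []       ys = refl
length-cartesianProductWith f (x ∷ xs) ys =
  trans (length-++ (map (f x) ys)) (cong₂ _+_ (length-map (f x) ys) (length-cartesianProductWith f xs ys))

-- Surjections

record Onto (v : Vec (Fin k) n) : Set where
  field
    preimage : ∀ l → ∃ λ i → lookup v i ≡ l

open Onto

onto-∷ : ∀ p {v : Vec (Fin k) n} → Onto v → Onto (p ∷ v)
preimage (onto-∷ p onto-v) l = let i , vᵢ≡l = preimage onto-v l in suc i , vᵢ≡l

onto-tail : ∀ {p} {v : Vec (Fin k) n} → (∃ λ i → lookup v i ≡ p) → Onto (p ∷ v) → Onto v
preimage (onto-tail {p = p} p∈v onto-pv) l with l ≟ p | preimage onto-pv l
... | yes refl | _           = p∈v
... | no  l≢p  | zero  , p≡l = ⊥-elim (l≢p (sym p≡l))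
... | no  _    | suc i , vᵢ≡l = i , vᵢ≡l

onto⇒≤ : {v : Vec (Fin k) n} → Onto v → k ≤ n
onto⇒≤ {v = v} onto-v = ≮⇒≥ λ n<k →
  let i , j , i<j , same = pigeonhole n<k (proj₁ ∘ preimage onto-v)
  in <⇒≢ᶠ i<j (trans (sym (proj₂ (preimage onto-v i)))
                     (trans (cong (lookup v) same) (proj₂ (preimage onto-v j))))

consNew : Fin (suc k) → Vec (Fin k) n → Vec (Fin (suc k)) (suc n)
consNew p v = p ∷ mapᵛ (punchIn p) v

consNew-injective : ∀ {p p′} {v v′ : Vec (Fin k) n} → consNew p v ≡ consNew p′ v′ → p ≡ p′ × v ≡ v′
consNew-injective {p = p} {v = v} {v′} eq with ∷-injective eq
... | refl , pv≡pv′ = refl , Pointwise-≡⇒≡ (ext λ i →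
  punchIn-injective p _ _ (trans (sym (lookup-map i (punchIn p) v))
                                (trans (cong (λ w → lookup w i) pv≡pv′) (lookup-map i (punchIn p) v′))))

onto-consNew : ∀ p {v : Vec (Fin k) n} → Onto v → Onto (consNew p v)
preimage (onto-consNew p {v} onto-v) l with p ≟ l
... | yes p≡l = zero , p≡l
... | no  p≢l = let i , vᵢ≡l′ = preimage onto-v (punchOut p≢l) in
  suc i , trans (lookup-map i (punchIn p) v) (trans (cong (punchIn p) vᵢ≡l′) (punchIn-punchOut p≢l))

consNew-head∉tail : ∀ p (v : Vec (Fin k) n) i → lookup (mapᵛ (punchIn p) v) i ≢ p
consNew-head∉tail p v i eq = punchInᵢ≢i p (lookup v i) (trans (sym (lookup-map i (punchIn p) v)) eq)

module _ {p : Fin (suc k)} {v : Vec (Fin (suc k)) n} (p∉v : ∀ i → p ≢ lookup v i) where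

  punchOutAll : Vec (Fin k) n
  punchOutAll = tabulate λ i → punchOut (p∉v i)

  consNew-punchOutAll : consNew p punchOutAll ≡ p ∷ v
  consNew-punchOutAll = cong (p ∷_) (Pointwise-≡⇒≡ (ext λ i →
    trans (lookup-map i (punchIn p) punchOutAll)
          (trans (cong (punchIn p) (lookup∘tabulate _ i)) (punchIn-punchOut (p∉v i)))))

  onto-punchOutAll : Onto (p ∷ v) → Onto punchOutAll
  preimage (onto-punchOutAll onto-pv) l with preimage onto-pv (punchIn p l)
  ... | zero  , p≡l′ = ⊥-elim (punchInᵢ≢i p l (sym p≡l′))
  ... | suc i , vᵢ≡l′ = i , trans (lookup∘tabulate _ i) (trans (punchOut-cong p vᵢ≡l′) (punchOut-punchIn p))

extendOld : List (Vec (Fin (suc k)) n) → List (Vec (Fin (suc k)) (suc n))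
extendOld = cartesianProductWith _∷_ (allFin _)

extendNew : List (Vec (Fin k) n) → List (Vec (Fin (suc k)) (suc n))
extendNew = cartesianProductWith consNew (allFin _)

-- The first element either shares its value with another one or is its only preimage,
-- as in S(n+1,k+1) = (k+1) S(n,k+1) + S(n,k).
surjections : (n k : ℕ) → List (Vec (Fin k) n)
surjections zero    zero    = [ [] ]
surjections zero    (suc k) = []
surjections (suc n) zero    = []
surjections (suc n) (suc k) = extendOld (surjections n (suc k)) ++ extendNew (surjections n k)

surjections-sound : {v : Vec (Fin k) n} → v ∈ surjections n k → Onto v
preimage (surjections-sound {zero} {zero} (here refl)) ()
surjections-sound {suc k} {suc n} v∈ with ∈-++⁻ (extendOld (surjections n (suc k))) v∈
... | inj₁ v∈old with ∈-cartesianProductWith⁻ _∷_ (allFin _) _ v∈old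
...   | p , t , _ , t∈ , refl = onto-∷ p (surjections-sound t∈)
surjections-sound {suc k} {suc n} v∈ | inj₂ v∈new with ∈-cartesianProductWith⁻ consNew (allFin _) _ v∈new
...   | p , t , _ , t∈ , refl = onto-consNew p (surjections-sound t∈)

surjections-complete : (v : Vec (Fin k) n) → Onto v → v ∈ surjections n k
surjections-complete {zero}  {zero}  []      _      = here refl
surjections-complete {suc k} {zero}  []      onto-v with () ← proj₁ (preimage onto-v zero)
surjections-complete {zero}  {suc n} (() ∷ _)
surjections-complete {suc k} {suc n} (p ∷ v) onto-pv with any? (λ i → lookup v i ≟ p)
... | yes p∈v =
  ∈-++⁺ˡ (∈-cartesianProductWith⁺ _∷_ (∈-allFin p) (surjections-complete v (onto-tail p∈v onto-pv)))
... | no  p∉v = ∈-++⁺ʳ (extendOld (surjections n (suc k)))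
  (subst (_∈ extendNew (surjections n k)) (consNew-punchOutAll p∉v′)
    (∈-cartesianProductWith⁺ consNew (∈-allFin p) (surjections-complete _ (onto-punchOutAll p∉v′ onto-pv))))
  where
  p∉v′ : ∀ i → p ≢ lookup v i
  p∉v′ i p≡vᵢ = p∉v (i , sym p≡vᵢ)

surjections-unique : ∀ n k → Unique (surjections n k)
surjections-unique zero    zero    = [] ∷ []
surjections-unique zero    (suc k) = []
surjections-unique (suc n) zero    = []
surjections-unique (suc n) (suc k) =
  Unique.++⁺ (Unique.cartesianProductWith⁺ _∷_ ∷-injective (Unique.allFin⁺ _) (surjections-unique n (suc k)))
             (Unique.cartesianProductWith⁺ consNew consNew-injective (Unique.allFin⁺ _) (surjections-unique n k))
             disjoint
  where
  disjoint : ∀ {w} → ¬ (w ∈ extendOld (surjections n (suc k)) × w ∈ extendNew (surjections n k))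
  disjoint (w∈old , w∈new) with ∈-cartesianProductWith⁻ _∷_ (allFin _) _ w∈old
                              | ∈-cartesianProductWith⁻ consNew (allFin _) _ w∈new
  ... | p , t , _ , t∈ , refl | p′ , t′ , _ , _ , eq with ∷-injective eq
  ... | refl , refl = let i , tᵢ≡p = preimage (surjections-sound t∈) p in consNew-head∉tail p t′ i tᵢ≡p

length-extendOld : (vs : List (Vec (Fin (suc k)) n)) → length (extendOld vs) ≡ suc k * length vs
length-extendOld {k} vs =
  trans (length-cartesianProductWith Vec._∷_ (allFin _) vs)
        (cong (_* length vs) (length-tabulate {n = suc k} (λ i → i)))

length-extendNew : (vs : List (Vec (Fin k) n)) → length (extendNew {k} vs) ≡ suc k * length vs
length-extendNew {k} vs =
  trans (length-cartesianProductWith consNew (allFin _) vs)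
        (cong (_* length vs) (length-tabulate {n = suc k} (λ i → i)))

length-surjections : ∀ n k → length (surjections n k) ≡ k ! * S n k
length-surjections zero    zero    = refl
length-surjections zero    (suc k) = sym (*-zeroʳ (suc k !))
length-surjections (suc n) zero    = refl
length-surjections (suc n) (suc k) = begin
  length (extendOld (surjections n (suc k)) ++ extendNew (surjections n k))
    ≡⟨ length-++ (extendOld (surjections n (suc k))) ⟩
  length (extendOld (surjections n (suc k))) + length (extendNew (surjections n k))
    ≡⟨ cong₂ _+_ (length-extendOld (surjections n (suc k))) (length-extendNew (surjections n k)) ⟩
  suc k * length (surjections n (suc k)) + suc k * length (surjections n k)
    ≡⟨ cong₂ (λ x y → suc k * x + suc k * y) (length-surjections n (suc k)) (length-surjections n k) ⟩
  suc k * (suc k ! * S n (suc k)) + suc k * (k ! * S n k)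
    ≡⟨ factor (suc k) (k !) (S n (suc k)) (S n k) ⟩
  suc k ! * S (suc n) (suc k) ∎
  where
  open ≡-Reasoning
  open +-*-Solver
  factor : ∀ a f x y → a * ((a * f) * x) + a * (f * y) ≡ (a * f) * (a * x + y)
  factor = solve 4 (λ a f x y → a :* ((a :* f) :* x) :+ a :* (f :* y) := (a :* f) :* (a :* x :+ y)) refl

-- Level graphs

alternate : Bool → ℕ → Bool
alternate b zero    = b
alternate b (suc l) = not (alternate b l)

alternate-not : ∀ b l → alternate (not b) l ≡ alternate b (suc l)
alternate-not b zero    = refl
alternate-not b (suc l) = cong not (alternate-not b l)

alternate-injective : ∀ l → alternate b l ≡ alternate b′ l → b ≡ b′
alternate-injective zero    eq = eq
alternate-injective (suc l) eq = alternate-injective l (not-injective eq)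

levelGraph : Bool → (Fin n → ℕ) → Adj n
levelGraph b f = tabulate λ i → tabulate λ j → alternate b (f i ⊓ f j)

adj-tabulate : (g : Fin n → Fin n → Bool) (i j : Fin n) → adj (tabulate λ i → tabulate (g i)) i j ≡ g i j
adj-tabulate g i j = trans (cong (λ row → lookup row j) (lookup∘tabulate _ i)) (lookup∘tabulate (g i) j)

adj-levelGraph : ∀ b (f : Fin n → ℕ) i j → adj (levelGraph b f) i j ≡ alternate b (f i ⊓ f j)
adj-levelGraph b f = adj-tabulate λ i j → alternate b (f i ⊓ f j)

adj-delete : (A : Adj (suc n)) (u : Fin (suc n)) (i j : Fin n) →
             adj (delete A u) i j ≡ adj A (punchIn u i) (punchIn u j)
adj-delete A u = adj-tabulate λ i j → adj A (punchIn u i) (punchIn u j)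

adj-ext : {A B : Adj n} → (∀ i j → adj A i j ≡ adj B i j) → A ≡ B
adj-ext h = Pointwise-≡⇒≡ (ext λ i → Pointwise-≡⇒≡ (ext (h i)))

levelGraph-symmetric : ∀ b (f : Fin n → ℕ) → Symmetric (levelGraph b f)
levelGraph-symmetric b f i j =
  trans (adj-levelGraph b f i j) (trans (cong (alternate b) (⊓-comm (f i) (f j))) (sym (adj-levelGraph b f j i)))

delete-symmetric : (A : Adj (suc n)) (u : Fin (suc n)) → Symmetric A → Symmetric (delete A u)
delete-symmetric A u sym-A i j =
  trans (adj-delete A u i j) (trans (sym-A _ _) (sym (adj-delete A u j i)))

delete-levelGraph : ∀ b (f : Fin (suc n) → ℕ) u → delete (levelGraph b f) u ≡ levelGraph b (f ∘ punchIn u)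
delete-levelGraph b f u = tabulate-cong λ i → tabulate-cong λ j → adj-levelGraph b f (punchIn u i) (punchIn u j)

constantRow⇒loopThreshold : {A : Adj (suc (suc n))} (u : Fin (suc (suc n))) →
                            (∀ j → adj A u j ≡ c) → LoopThreshold (delete A u) → LoopThreshold A
constantRow⇒loopThreshold {c = false} = isolated _
constantRow⇒loopThreshold {c = true}  = dominating _

-- A vertex of least level has a constant row.
levelGraph-loopThreshold : ∀ b (f : Fin (suc m) → ℕ) → LoopThreshold (levelGraph b f)
levelGraph-loopThreshold {zero}  b f = single _
levelGraph-loopThreshold {suc m} b f =
  constantRow⇒loopThreshold u row
    (subst LoopThreshold (sym (delete-levelGraph b f u)) (levelGraph-loopThreshold b (f ∘ punchIn u)))
  where
  u : Fin (suc (suc m))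
  u = argmin f zero (allFin _)
  u-minimal : ∀ j → f u ≤ f j
  u-minimal j = All.lookup (f[argmin]≤f[xs] {f = f} zero (allFin _)) (∈-allFin j)
  row : ∀ j → adj (levelGraph b f) u j ≡ alternate b (f u)
  row j = trans (adj-levelGraph b f u j) (cong (alternate b) (m≤n⇒m⊓n≡m (u-minimal j)))

levelGraph-isLTGraph : ∀ b (f : Fin (suc m) → ℕ) → IsLTGraph (levelGraph b f)
levelGraph-isLTGraph b f = levelGraph-symmetric b f , levelGraph-loopThreshold b f

-- Loop-threshold graphs are level graphs

Realises : Bool → (Fin n → ℕ) → Adj n → Set
Realises b f A = ∀ i j → adj A i j ≡ alternate b (f i ⊓ f j)

realises⇒≡levelGraph : {A : Adj n} {f : Fin n → ℕ} → Realises b f A → A ≡ levelGraph b f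
realises⇒≡levelGraph {b = b} {f = f} r = adj-ext λ i j → trans (r i j) (sym (adj-levelGraph b f i j))

realises-cong : {A : Adj n} {f g : Fin n → ℕ} → f ≗ g → Realises b f A → Realises b g A
realises-cong {b = b} f≗g r i j = trans (r i j) (cong₂ (λ x y → alternate b (x ⊓ y)) (f≗g i) (f≗g j))

realises-shift : {A : Adj n} {f : Fin n → ℕ} → Realises (not b) f A → Realises b (suc ∘ f) A
realises-shift {b = b} {f = f} r i j = trans (r i j) (alternate-not b (f i ⊓ f j))

data PunchInView (u : Fin (suc n)) : Fin (suc n) → Set where
  at        : PunchInView u u
  punchedIn : ∀ i → PunchInView u (punchIn u i)

punchInView : (u x : Fin (suc n)) → PunchInView u x
punchInView u x with u ≟ x
... | yes refl = at
... | no  u≢x  = subst (PunchInView u) (punchIn-punchOut u≢x) (punchedIn (punchOut u≢x))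

realises-delete : (A : Adj (suc (suc n))) (u : Fin (suc (suc n))) {f : Fin (suc (suc n)) → ℕ} →
                  Symmetric A → (∀ j → adj A u j ≡ c) → f u ≡ 0 →
                  Realises c (f ∘ punchIn u) (delete A u) → Realises c f A
realises-delete {c = c} A u {f} sym-A row fᵤ≡0 r x y with punchInView u x | punchInView u y
... | at          | _     = trans (row y) (cong (λ l → alternate c (l ⊓ f y)) (sym fᵤ≡0))
... | punchedIn i | at    =
  trans (sym-A _ u)
        (trans (row _) (cong (alternate c) (sym (trans (cong (f (punchIn u i) ⊓_) fᵤ≡0) (⊓-zeroʳ _)))))
... | punchedIn i | punchedIn j = trans (sym (adj-delete A u i j)) (r i j)

level : Vec (Fin k) n → Fin n → ℕ
level v = toℕ ∘ lookup v

LevelCode : Adj n → Set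
LevelCode {n} A = ∃₂ λ b k → Σ (Vec (Fin k) n) λ v → Onto v × Realises b (level v) A

onto-insertAt : {w : Vec (Fin k) n} {x : Fin k} (u : Fin (suc n)) →
                (∀ l → x ≡ l ⊎ ∃ λ i → lookup w i ≡ l) → Onto (insertAt w u x)
preimage (onto-insertAt {w = w} {x} u covers) l with covers l
... | inj₁ x≡l         = u , trans (insertAt-lookup w u x) x≡l
... | inj₂ (i , wᵢ≡l) = punchIn u i , trans (insertAt-punchIn w u x i) wᵢ≡l

level-insertAt-punchIn : (w : Vec (Fin k) n) (u : Fin (suc n)) (x : Fin k) →
                         level (insertAt w u x) ∘ punchIn u ≗ level w
level-insertAt-punchIn w u x i = cong toℕ (insertAt-punchIn w u x i)

-- u is put in the lowest level: a new one if its type differs from that of the old level 0.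
levelCode-extend : (A : Adj (suc (suc n))) (u : Fin (suc (suc n))) → Symmetric A →
                   (∀ j → adj A u j ≡ c) → LevelCode (delete A u) → LevelCode A
levelCode-extend A u sym-A row (b , zero , v , _) with () ← lookup v zero
levelCode-extend {n = n} {c = c} A u sym-A row (b , suc k , v , onto-v , r) with b ≟ᵇ c
... | yes refl =
  c , suc k , v′ , onto-insertAt u (inj₂ ∘ preimage onto-v) , realises-delete A u {level v′} sym-A row v′ᵤ≡0 rest
  where
  v′ : Vec (Fin (suc k)) (suc (suc n))
  v′ = insertAt v u zero
  v′ᵤ≡0 : level v′ u ≡ 0
  v′ᵤ≡0 = cong toℕ (insertAt-lookup v u zero)
  rest : Realises c (level v′ ∘ punchIn u) (delete A u)
  rest = realises-cong {A = delete A u} {f = level v} (λ i → sym (level-insertAt-punchIn v u zero i)) r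
... | no  b≢c  =
  c , suc (suc k) , v′ , onto-insertAt u covers , realises-delete A u {level v′} sym-A row v′ᵤ≡0 rest
  where
  v′ : Vec (Fin (suc (suc k))) (suc (suc n))
  v′ = insertAt (mapᵛ suc v) u zero
  v′ᵤ≡0 : level v′ u ≡ 0
  v′ᵤ≡0 = cong toℕ (insertAt-lookup (mapᵛ suc v) u zero)
  covers : ∀ l → zero ≡ l ⊎ ∃ λ i → lookup (mapᵛ suc v) i ≡ l
  covers zero    = inj₁ refl
  covers (suc l) = let i , vᵢ≡l = preimage onto-v l in inj₂ (i , trans (lookup-map i suc v) (cong suc vᵢ≡l))
  shifted : Realises c (suc ∘ level v) (delete A u)
  shifted = realises-shift {A = delete A u} {f = level v}
    (subst (λ b → Realises b (level v) (delete A u)) (¬-not b≢c) r)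
  rest : Realises c (level v′ ∘ punchIn u) (delete A u)
  rest = realises-cong {A = delete A u} {f = suc ∘ level v}
    (λ i → sym (trans (level-insertAt-punchIn (mapᵛ suc v) u zero i) (cong toℕ (lookup-map i suc v)))) shifted

levelCode : (A : Adj n) → Symmetric A → LoopThreshold A → LevelCode A
levelCode A _     (single A)              =
  adj A zero zero , 1 , zero ∷ [] , record { preimage = λ { zero → zero , refl } } , λ { zero zero → refl }
levelCode A sym-A (isolated A u row lt)   = levelCode-extend A u sym-A row (levelCode _ (delete-symmetric A u sym-A) lt)
levelCode A sym-A (dominating A u row lt) = levelCode-extend A u sym-A row (levelCode _ (delete-symmetric A u sym-A) lt)

-- A level graph determines its levels and its colour

DownClosed : (Fin n → ℕ) → Set
DownClosed f = ∀ i l → l < f i → ∃ λ j → f j ≡ l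

onto⇒downClosed : {v : Vec (Fin k) n} → Onto v → DownClosed (level v)
onto⇒downClosed {v = v} onto-v i l l<vᵢ =
  let j , vⱼ≡l = preimage onto-v (fromℕ< (<-trans l<vᵢ (toℕ<n (lookup v i))))
  in j , trans (cong toℕ vⱼ≡l) (toℕ-fromℕ< _)

levelGraph-agree : {f f′ : Fin n → ℕ} → levelGraph b f ≡ levelGraph b′ f′ →
                   ∀ i j → alternate b (f i ⊓ f j) ≡ alternate b′ (f′ i ⊓ f′ j)
levelGraph-agree {b = b} {b′} {f} {f′} same i j =
  trans (sym (adj-levelGraph b f i j)) (trans (cong (λ A → adj A i j) same) (adj-levelGraph b′ f′ i j))

-- If l < f i but f′ i = l, the row of i would be constant on the f-levels ≥ l (as these have
-- f′-levels ≥ l), yet f provides vertices of levels l and l + 1 there, with different entries.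
levelGraph-levels-≤ : {f f′ : Fin n → ℕ} → DownClosed f → levelGraph b f ≡ levelGraph b′ f′ →
                      ∀ i → f i ≤ f′ i
levelGraph-levels-≤ {b = b} {b′} {f} {f′} closed same i = bound (f i) i ≤-refl
  where
  reach : ∀ {l} i → l ≤ f i → ∃ λ j → f j ≡ l
  reach i l≤fᵢ with m≤n⇒m<n∨m≡n l≤fᵢ
  ... | inj₁ l<fᵢ = closed i _ l<fᵢ
  ... | inj₂ l≡fᵢ = i , sym l≡fᵢ

  bound : ∀ l i → l ≤ f i → l ≤ f′ i
  bound zero    i _    = z≤n
  bound (suc l) i l<fᵢ with m≤n⇒m<n∨m≡n (bound l i (<⇒≤ l<fᵢ))
  ... | inj₁ l<f′ᵢ = l<f′ᵢ
  ... | inj₂ l≡f′ᵢ =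
    ⊥-elim (not-¬ refl (trans (rowValue ≤-refl (<⇒≤ l<fᵢ)) (sym (rowValue (n≤1+n l) l<fᵢ))))
    where
    open ≡-Reasoning
    rowValue : ∀ {x} → l ≤ x → x ≤ f i → alternate b x ≡ alternate b′ l
    rowValue {x} l≤x x≤fᵢ = let j , fⱼ≡x = reach i x≤fᵢ in begin
      alternate b x
        ≡⟨ cong (alternate b) (sym (trans (cong (f i ⊓_) fⱼ≡x) (m≥n⇒m⊓n≡n x≤fᵢ))) ⟩
      alternate b (f i ⊓ f j)
        ≡⟨ levelGraph-agree {f = f} {f′} same i j ⟩
      alternate b′ (f′ i ⊓ f′ j)
        ≡⟨ cong (λ y → alternate b′ (y ⊓ f′ j)) (sym l≡f′ᵢ) ⟩
      alternate b′ (l ⊓ f′ j)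
        ≡⟨ cong (alternate b′) (m≤n⇒m⊓n≡m (bound l j (subst (l ≤_) (sym fⱼ≡x) l≤x))) ⟩
      alternate b′ l
        ∎

levelGraph-levels-unique : {f f′ : Fin n → ℕ} → DownClosed f → DownClosed f′ →
                           levelGraph b f ≡ levelGraph b′ f′ → f ≗ f′
levelGraph-levels-unique {f = f} {f′} closed closed′ same i =
  ≤-antisym (levelGraph-levels-≤ {f = f} {f′} closed same i)
            (levelGraph-levels-≤ {f = f′} {f} closed′ (sym same) i)

levelGraph-colour-unique : {f f′ : Fin n → ℕ} → f ≗ f′ → levelGraph b f ≡ levelGraph b′ f′ →
                           Fin n → b ≡ b′
levelGraph-colour-unique {b′ = b′} {f} {f′} f≗f′ same i = alternate-injective (f i ⊓ f i)
  (trans (levelGraph-agree {f = f} {f′} same i i) (cong (λ x → alternate b′ (x ⊓ x)) (sym (f≗f′ i))))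

onto-levelGraph-injective : {v : Vec (Fin k) n} {v′ : Vec (Fin k′) n} → Onto v → Onto v′ →
                            levelGraph b (level v) ≡ levelGraph b′ (level v′) → level v ≗ level v′
onto-levelGraph-injective onto-v onto-v′ =
  levelGraph-levels-unique (onto⇒downClosed onto-v) (onto⇒downClosed onto-v′)

onto-size-≤ : {v : Vec (Fin k) n} {v′ : Vec (Fin k′) n} → Onto v → level v ≗ level v′ → k ≤ k′
onto-size-≤ {zero}  _ _ = z≤n
onto-size-≤ {suc k} {v = v} {v′} onto-v same = let i , vᵢ≡top = preimage onto-v (fromℕ k) in
  subst (_< _) (trans (sym (same i)) (trans (cong toℕ vᵢ≡top) (toℕ-fromℕ k))) (toℕ<n (lookup v′ i))

level-injective : {v v′ : Vec (Fin k) n} → level v ≗ level v′ → v ≡ v′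
level-injective same = Pointwise-≡⇒≡ (ext λ i → toℕ-injective (same i))

-- Counting

levelGraphs : Bool → (n k : ℕ) → List (Adj n)
levelGraphs b n k = map (levelGraph b ∘ level) (surjections n k)

levelGraphsOfColour : Bool → (n : ℕ) → List (Adj n)
levelGraphsOfColour b n = concatMap (levelGraphs b n) (applyUpTo suc n)

loopThresholdGraphs : (n : ℕ) → List (Adj n)
loopThresholdGraphs n = levelGraphsOfColour true n ++ levelGraphsOfColour false n

∈-levelGraphsOfColour⁻ : {A : Adj n} → A ∈ levelGraphsOfColour b n →
                         ∃₂ λ k (v : Vec (Fin k) n) → Onto v × A ≡ levelGraph b (level v)
∈-levelGraphsOfColour⁻ {n = n} {b = b} A∈
  with satisfied (∈-concatMap⁻ (levelGraphs b n) {xs = applyUpTo suc n} A∈)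
... | k , A∈ₖ with ∈-map⁻ (levelGraph b ∘ level) A∈ₖ
... | v , v∈ , A≡ = k , v , surjections-sound v∈ , A≡

∈-levelGraphsOfColour⁺ : {v : Vec (Fin k) (suc m)} → Onto v →
                         levelGraph b (level v) ∈ levelGraphsOfColour b (suc m)
∈-levelGraphsOfColour⁺ {k = zero} {v = () ∷ _}
∈-levelGraphsOfColour⁺ {k = suc k} {b = b} {v = v} onto-v = ∈-concatMap⁺ (levelGraphs b _)
  (lose (∈-applyUpTo⁺ suc (onto⇒≤ onto-v)) (∈-map⁺ (levelGraph b ∘ level) (surjections-complete v onto-v)))

∈-loopThresholdGraphs⁻ : {A : Adj n} → A ∈ loopThresholdGraphs n →
                         ∃₂ λ b (f : Fin n → ℕ) → A ≡ levelGraph b f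
∈-loopThresholdGraphs⁻ {n = n} A∈ with ∈-++⁻ (levelGraphsOfColour true n) A∈
... | inj₁ A∈ₜ = let _ , v , _ , A≡ = ∈-levelGraphsOfColour⁻ A∈ₜ in true , level v , A≡
... | inj₂ A∈f = let _ , v , _ , A≡ = ∈-levelGraphsOfColour⁻ A∈f in false , level v , A≡

∈-loopThresholdGraphs⁺ : ∀ b {v : Vec (Fin k) (suc m)} → Onto v →
                         levelGraph b (level v) ∈ loopThresholdGraphs (suc m)
∈-loopThresholdGraphs⁺ true  onto-v = ∈-++⁺ˡ (∈-levelGraphsOfColour⁺ onto-v)
∈-loopThresholdGraphs⁺ false onto-v = ∈-++⁺ʳ (levelGraphsOfColour true _) (∈-levelGraphsOfColour⁺ onto-v)

∈-loopThresholdGraphs⇔ : (A : Adj (suc m)) → A ∈ loopThresholdGraphs (suc m) ⇔ IsLTGraph A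
∈-loopThresholdGraphs⇔ {m} A = mk⇔ to from
  where
  to : A ∈ loopThresholdGraphs (suc m) → IsLTGraph A
  to A∈ = let b , f , A≡ = ∈-loopThresholdGraphs⁻ A∈ in subst IsLTGraph (sym A≡) (levelGraph-isLTGraph b f)
  from : IsLTGraph A → A ∈ loopThresholdGraphs (suc m)
  from (sym-A , lt) = let b , k , v , onto-v , r = levelCode A sym-A lt in
    subst (_∈ loopThresholdGraphs (suc m)) (sym (realises⇒≡levelGraph {f = level v} r))
          (∈-loopThresholdGraphs⁺ b onto-v)

levelGraphsOfColour-unique : ∀ b n → Unique (levelGraphsOfColour b n)
levelGraphsOfColour-unique b n =
  unique-concatMap⁺ (Unique.applyUpTo⁺₁ suc n λ i<j _ → <⇒≢ (s≤s i<j)) levelGraphs-unique separated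
  where
  levelGraphs-unique : ∀ k → Unique (levelGraphs b n k)
  levelGraphs-unique k = unique-map⁺-on
    (λ onto-v onto-v′ same → level-injective (onto-levelGraph-injective onto-v onto-v′ same))
    (All.tabulate surjections-sound) (surjections-unique n k)
  separated : ∀ {k k′ A} → A ∈ levelGraphs b n k → A ∈ levelGraphs b n k′ → k ≡ k′
  separated A∈ A∈′ with ∈-map⁻ (levelGraph b ∘ level) A∈ | ∈-map⁻ (levelGraph b ∘ level) A∈′
  ... | v , v∈ , refl | v′ , v′∈ , same =
    let onto-v = surjections-sound v∈
        onto-v′ = surjections-sound v′∈
        levels = onto-levelGraph-injective onto-v onto-v′ same
    in ≤-antisym (onto-size-≤ {v′ = v′} onto-v levels) (onto-size-≤ {v′ = v} onto-v′ (sym ∘ levels))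

loopThresholdGraphs-unique : ∀ m → Unique (loopThresholdGraphs (suc m))
loopThresholdGraphs-unique m =
  Unique.++⁺ (levelGraphsOfColour-unique true (suc m)) (levelGraphsOfColour-unique false (suc m)) disjoint
  where
  disjoint : ∀ {A} → ¬ (A ∈ levelGraphsOfColour true (suc m) × A ∈ levelGraphsOfColour false (suc m))
  disjoint (A∈ , A∈′) with ∈-levelGraphsOfColour⁻ A∈ | ∈-levelGraphsOfColour⁻ A∈′
  ... | _ , v , onto-v , refl | _ , v′ , onto-v′ , same
    with () ← levelGraph-colour-unique (onto-levelGraph-injective onto-v onto-v′ same) same zero

length-levelGraphsOfColour : ∀ b n → length (levelGraphsOfColour b n) ≡ fubiniSum n
length-levelGraphsOfColour b n = trans (length-concatMap (levelGraphs b n) (applyUpTo suc n))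
  (cong sum (map-cong (λ k → trans (length-map (levelGraph b ∘ level) (surjections n k)) (length-surjections n k))
                      (applyUpTo suc n)))

length-loopThresholdGraphs : ∀ n → length (loopThresholdGraphs n) ≡ 2 * fubiniSum n
length-loopThresholdGraphs n = trans (length-++ (levelGraphsOfColour true n))
  (cong₂ _+_ (length-levelGraphsOfColour true n) (trans (length-levelGraphsOfColour false n) (sym (+-identityʳ _))))

mainTheorem5 : (m : ℕ) →
    Σ (List (Adj (suc m))) λ gs →
    Unique gs ×
    ((A : Adj (suc m)) → (A ∈ gs) ⇔ IsLTGraph A) ×
    length gs ≡ 2 * fubiniSum (suc m)
mainTheorem5 m =
  loopThresholdGraphs (suc m) ,
  loopThresholdGraphs-unique m ,
  ∈-loopThresholdGraphs⇔ ,
  length-loopThresholdGraphs (suc m)
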